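{- Let $n$ be a positive integer, $\mathbb{F}$ a finite field of order $c$ with $c\equiv1\pmod{2n}$, $\zeta$ a primitive element of $\mathbb{F}$, and $H=N\rtimes\langle\zeta^n\rangle\le\mathrm{AGL}(1,c)$ where $N$ is the translation group of $\mathbb{F}$. Let $d\ge 2$, $R=\mathbb{Z}_d$, $K=\mathrm{Sym}(d)$ acting on $R$, and $G=H\wr K$ acting on $\mathbb{F}\times R$ by $(x,j)^{(h_1,\dots,h_d)\sigma}=(x^{h_j},j^\sigma)$. Then: (a) the partition $\mathscr{C}$ of $\mathbb{F}\times R$ with classes $C_j=\{(x,j):x\in\mathbb{F}\}$, $j\in R$, is non-trivial and $G$-invariant; (b) $G$ is transitive on the set $\mathscr{O}_{out}$ of unordered pairs of points in different classes of $\mathscr{C}$, and $|\mathscr{O}_{out}|=c^2d(d-1)/2$; (c) $G$ has exactly $n$ orbits on the set of unordered pairs of distinct points lying in a common class of $\mathscr{C}$, namely $\mathscr{O}_{inn,i}=\{\{(x,j),(y,j)\}:\{x,y\}\in\mathscr{O}_i,\ j\in R\}$ for $0\le i<n$, where $\mathscr{O}_i=\{\{x,y\}: y-x\in\{\zeta^{i+tn}:t\ge 0\}\}$; and $|\mathscr{O}_{inn,i}|=dc(c-1)/(2n)$ for each $i$.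
   Context: $\mathrm{AGL}(1,c)$ is the group of maps $x\mapsto ax+b$ on $\mathbb{F}$ with $a\ne 0$; $\zeta^n$ acts by multiplication. The sets $\mathscr{O}_i$ are the $H$-orbits on $2$-subsets of $\mathbb{F}$, equivalently $\mathscr{O}_i=\{\{\alpha,\beta\}:(\alpha,\beta)\in(0,\zeta^i)^H\}$. -}

module Defs where

open import Level using (0ℓ)
open import Data.Nat using (ℕ; zero; suc) renaming (_+_ to _+ℕ_; _*_ to _*ℕ_)
open import Data.Fin using (Fin; toℕ)
open import Data.Fin.Permutation using (Permutation′; _⟨$⟩ʳ_)
open import Data.Product using (Σ; ∃; _×_; _,_; proj₁; proj₂)
open import Data.Sum using (_⊎_; inj₁; inj₂)
open import Relation.Nullary using (¬_)
open import Relation.Binary.PropositionalEquality using (_≡_; refl; sym; trans)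
import Relation.Binary.PropositionalEquality as ≡
open import Relation.Binary.Bundles using (Setoid)
open import Relation.Binary.Structures using (IsEquivalence)
open import Function.Bundles using (_↔_; Bijection)
open import Algebra.Structures using (IsCommutativeRing)

record FiniteField (c : ℕ) : Set₁ where
  infixl 7 _*_
  infixl 6 _+_
  field
    Carrier : Set
    _+_ _*_ : Carrier → Carrier → Carrier
    -_ : Carrier → Carrier
    0# 1# : Carrier
    isCommutativeRing : IsCommutativeRing _≡_ _+_ _*_ -_ 0# 1#
    0≢1 : ¬ (0# ≡ 1#)
    inverse : ∀ x → ¬ (x ≡ 0#) → ∃ λ y → x * y ≡ 1#
    enumeration : Fin c ↔ Carrier

  _-_ : Carrier → Carrier → Carrier
  x - y = x + (- y)

  _^_ : Carrier → ℕ → Carrier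
  x ^ zero = 1#
  x ^ suc k = x * (x ^ k)

-- Unordered pairs of distinct elements of a type, as a setoid.

record UPair (X : Set) : Set where
  constructor ⟅_,_⟆⟨_⟩
  field
    fst snd : X
    distinct : ¬ (fst ≡ snd)
open UPair public

SameRaw : {X : Set} → X × X → X × X → Set
SameRaw (p , q) (p' , q') = (p ≡ p' × q ≡ q') ⊎ (p ≡ q' × q ≡ p')

_≈ᵘ_ : {X : Set} → UPair X → UPair X → Set
u ≈ᵘ v = SameRaw (fst u , snd u) (fst v , snd v)

UPairSetoid : (X : Set) → (UPair X → Set) → Setoid 0ℓ 0ℓ
UPairSetoid X P = record
  { Carrier = Σ (UPair X) P
  ; _≈_ = λ u v → proj₁ u ≈ᵘ proj₁ v
  ; isEquivalence = record
    { refl = inj₁ (refl , refl)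
    ; sym = λ { (inj₁ (a , b)) → inj₁ (sym a , sym b)
              ; (inj₂ (a , b)) → inj₂ (sym b , sym a) }
    ; trans = λ { (inj₁ (a , b)) (inj₁ (e , f)) → inj₁ (trans a e , trans b f)
                ; (inj₁ (a , b)) (inj₂ (e , f)) → inj₂ (trans a e , trans b f)
                ; (inj₂ (a , b)) (inj₁ (e , f)) → inj₂ (trans a f , trans b e)
                ; (inj₂ (a , b)) (inj₂ (e , f)) → inj₁ (trans a f , trans b e) }
    }
  }

HasSize : Setoid 0ℓ 0ℓ → ℕ → Set
HasSize S m = Bijection (≡.setoid (Fin m)) S

Primitive : {c : ℕ} (F : FiniteField c) → FiniteField.Carrier F → Set
Primitive F ζ = ∀ x → ¬ (x ≡ 0#) → ∃ λ k → x ≡ ζ ^ k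
  where open FiniteField F

module Setup {c : ℕ} (F : FiniteField c) (ζ : FiniteField.Carrier F) (n d : ℕ) where
  open FiniteField F

  -- elements of H = N ⋊ ⟨ζ^n⟩ ≤ AGL(1,c): maps x ↦ a x + b with a ∈ ⟨ζ^n⟩
  record HElt : Set where
    field
      a b : Carrier
      a∈⟨ζⁿ⟩ : ∃ λ t → a ≡ ζ ^ (n *ℕ t)

  applyH : HElt → Carrier → Carrier
  applyH h x = HElt.a h * x + HElt.b h

  Point : Set
  Point = Carrier × Fin d

  GElt : Set
  GElt = (Fin d → HElt) × Permutation′ d

  act : GElt → Point → Point
  act (h , σ) (x , j) = applyH (h j) x , σ ⟨$⟩ʳ j

  MapsTo : GElt → UPair Point → UPair Point → Set
  MapsTo g u v = SameRaw (act g (fst u) , act g (snd u)) (fst v , snd v)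

  InClass : Fin d → Point → Set
  InClass j p = proj₂ p ≡ j

  Out : UPair Point → Set
  Out u = ¬ (proj₂ (fst u) ≡ proj₂ (snd u))

  Inner : UPair Point → Set
  Inner u = proj₂ (fst u) ≡ proj₂ (snd u)

  InOrd : ℕ → Carrier → Carrier → Set
  InOrd i x y = ∃ λ t → y - x ≡ ζ ^ (i +ℕ t *ℕ n)

  InO : ℕ → Carrier → Carrier → Set
  InO i x y = InOrd i x y ⊎ InOrd i y x

  Inn : ℕ → UPair Point → Set
  Inn i u = Inner u × InO i (proj₁ (fst u)) (proj₁ (snd u))

{-# OPTIONS --safe #-}
-- Write c = 1 + r and r = 2 q n, so that ζ has order r and ζ^(q n) = -1.  The permutation component
-- of G moves the classes, so the partition is G-invariant; Sym(d) is 2-transitive and translations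
-- move points freely inside a class, so G is transitive on pairs in distinct classes.  For a pair
-- {x, y} in one class, y - x = ζ^k with k determined modulo r up to adding q n, a multiple of n, so
-- k mod n is an invariant; elements of H multiply differences by powers of ζ^n, which preserves it,
-- and an affine map with multiplier ζ^(n t) sends any pair with invariant i to any other.  The
-- orbit sizes are counted through canonical representatives: for an inner pair, the endpoint from
-- which the difference has discrete logarithm below q n.
module Submission where

open import Defs
open import Level using (0ℓ)
open import Algebra.Bundles using (CommutativeRing)
open import Data.Empty using (⊥-elim)
open import Data.Fin as Fin using (Fin; toℕ)
import Data.Fin.Properties as Fin
open import Data.Fin.Permutation as Perm using (Permutation′; _⟨$⟩ʳ_; _⟨$⟩ˡ_)
open import Data.Nat
  using (ℕ; zero; suc; _∸_; _≤_; _<_; z≤n; s≤s; z<s; s<s; s≤s⁻¹; s<s⁻¹; NonZero; >-nonZero)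
  renaming (_+_ to _+ℕ_; _*_ to _*ℕ_)
import Data.Nat.Properties as ℕ
open import Data.Nat.DivMod
  using (_%_; _/_; _mod_; m%n<n; m≡m%n+[m/n]*n; m∣n⇒o%n%m≡o%m; [m+kn]%n≡m%n; m<n⇒m%n≡m;
         m<n*o⇒m/o<n; +-distrib-/-∣ʳ; m<n⇒m/n≡0; m*n/n≡m)
open import Data.Nat.Divisibility using (_∣_; divides; ∣⇒≤)
open import Data.Nat.Tactic.RingSolver using (solve-∀)
open import Data.Product using (Σ; ∃; ∃-syntax; _×_; _,_; proj₁; proj₂)
open import Data.Product.Function.NonDependent.Propositional using (_×-↔_)
open import Data.Sum using (_⊎_; inj₁; inj₂; [_,_]′; map) renaming (swap to ⊎-swap)
open import Data.Sum.Function.Propositional using (_⊎-↔_)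
open import Function using (_∘_; id; _↔_; mk↔ₛ′; Inverse; Injection)
open import Function.Properties.Inverse using (↔-refl; ↔-sym; ↔-trans; ↔⇒↣)
open import Relation.Binary.Bundles using (Setoid)
open import Relation.Binary.Definitions using (tri<; tri≈; tri>)
open import Relation.Binary.PropositionalEquality
  using (_≡_; _≢_; refl; sym; trans; cong; cong₂; subst; module ≡-Reasoning)
open import Relation.Nullary using (¬_; Dec; yes; no)
open import Relation.Nullary.Decidable using (via-injection; recompute)

module _ (S : Setoid 0ℓ 0ℓ) where
  open Setoid S using (Carrier; _≈_)

  hasSize-byCanonicalForm : {A : Set} {m : ℕ} → Fin m ↔ A →
    (rep : A → Carrier) (code : Carrier → A) →
    (∀ a → code (rep a) ≡ a) → (∀ s → rep (code s) ≈ s) →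
    (∀ s t → s ≈ t → code s ≡ code t) → HasSize S m
  hasSize-byCanonicalForm enum rep code code-rep rep-code code-cong = record
    { to = rep ∘ E.to
    ; cong = λ { refl → Setoid.refl S }
    ; bijective = injective , surjective
    }
    where
    module E = Inverse enum
    injective : ∀ {i j} → rep (E.to i) ≈ rep (E.to j) → i ≡ j
    injective {i} {j} e = begin
      i                              ≡⟨ E.strictlyInverseʳ i ⟨
      E.from (E.to i)                ≡⟨ cong E.from (code-rep (E.to i)) ⟨
      E.from (code (rep (E.to i)))   ≡⟨ cong E.from (code-cong _ _ e) ⟩
      E.from (code (rep (E.to j)))   ≡⟨ cong E.from (code-rep (E.to j)) ⟩
      E.from (E.to j)                ≡⟨ E.strictlyInverseʳ j ⟩
      j                              ∎
      where open ≡-Reasoning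
    surjective : ∀ s → ∃ λ i → ∀ {j} → j ≡ i → rep (E.to j) ≈ s
    surjective s = E.from (code s) ,
      λ { refl → subst (λ a → rep a ≈ s) (sym (E.strictlyInverseˡ (code s))) (rep-code s) }

variable
  d : ℕ

-- the order proof is irrelevant, so two increasing pairs are equal as soon as their endpoints are
record IncreasingPair (d : ℕ) : Set where
  constructor increasing
  field
    lo hi : Fin d
    .lo<hi : lo Fin.< hi

lo≢hi : (p : IncreasingPair d) → IncreasingPair.lo p ≢ IncreasingPair.hi p
lo≢hi (increasing j k j<k) = Fin.<⇒≢ (recompute (j Fin.<? k) j<k)

choose2 : ℕ → ℕ
choose2 zero = 0
choose2 (suc d) = d +ℕ choose2 d

double-choose2 : ∀ d → 2 *ℕ choose2 d ≡ d *ℕ (d ∸ 1)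
double-choose2 zero = refl
double-choose2 (suc zero) = refl
double-choose2 (suc (suc d)) = begin
  2 *ℕ (suc d +ℕ choose2 (suc d))        ≡⟨ ℕ.*-distribˡ-+ 2 (suc d) (choose2 (suc d)) ⟩
  2 *ℕ suc d +ℕ 2 *ℕ choose2 (suc d)     ≡⟨ cong₂ _+ℕ_ (ℕ.*-comm 2 (suc d)) (double-choose2 (suc d)) ⟩
  suc d *ℕ 2 +ℕ suc d *ℕ d               ≡⟨ ℕ.*-distribˡ-+ (suc d) 2 d ⟨
  suc d *ℕ (2 +ℕ d)                      ≡⟨ ℕ.*-comm (suc d) (2 +ℕ d) ⟩
  (2 +ℕ d) *ℕ suc d                      ∎
  where open ≡-Reasoning

increasingPair-suc : IncreasingPair (suc d) ↔ (Fin d ⊎ IncreasingPair d)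
increasingPair-suc = mk↔ₛ′ to from to-from from-to
  where
  to : IncreasingPair (suc d) → Fin d ⊎ IncreasingPair d
  to (increasing Fin.zero (Fin.suc k) _) = inj₁ k
  to (increasing (Fin.suc j) (Fin.suc k) j<k) = inj₂ (increasing j k (s<s⁻¹ j<k))
  from : Fin d ⊎ IncreasingPair d → IncreasingPair (suc d)
  from (inj₁ k) = increasing Fin.zero (Fin.suc k) z<s
  from (inj₂ (increasing j k j<k)) = increasing (Fin.suc j) (Fin.suc k) (s<s j<k)
  to-from : ∀ p → to (from p) ≡ p
  to-from (inj₁ k) = refl
  to-from (inj₂ (increasing j k _)) = refl
  from-to : ∀ p → from (to p) ≡ p
  from-to (increasing Fin.zero (Fin.suc k) _) = refl
  from-to (increasing (Fin.suc j) (Fin.suc k) _) = refl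

choose2↔increasingPair : ∀ d → Fin (choose2 d) ↔ IncreasingPair d
choose2↔increasingPair zero = mk↔ₛ′ (λ ()) (λ ()) (λ ()) (λ ())
choose2↔increasingPair (suc d) =
  ↔-trans (Fin.+↔⊎ {d}) (↔-trans (↔-refl ⊎-↔ choose2↔increasingPair d) (↔-sym increasingPair-suc))

transpose-left : ∀ {m} (i j : Fin m) → Perm.transpose i j ⟨$⟩ʳ i ≡ j
transpose-left i j with i Fin.≟ i
... | yes _ = refl
... | no i≢i = ⊥-elim (i≢i refl)

transpose-other : ∀ {m} {i j k : Fin m} → k ≢ i → k ≢ j → Perm.transpose i j ⟨$⟩ʳ k ≡ k
transpose-other {i = i} {j} {k} k≢i k≢j with k Fin.≟ i
... | yes k≡i = ⊥-elim (k≢i k≡i)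
... | no _ with k Fin.≟ j
...   | yes k≡j = ⊥-elim (k≢j k≡j)
...   | no _ = refl

permutation-injective : ∀ {m} (π : Permutation′ m) {i j} → π ⟨$⟩ʳ i ≡ π ⟨$⟩ʳ j → i ≡ j
permutation-injective π {i} {j} e = begin
  i                   ≡⟨ Perm.inverseˡ π ⟨
  π ⟨$⟩ˡ (π ⟨$⟩ʳ i)   ≡⟨ cong (π ⟨$⟩ˡ_) e ⟩
  π ⟨$⟩ˡ (π ⟨$⟩ʳ j)   ≡⟨ Perm.inverseˡ π ⟩
  j                   ∎
  where open ≡-Reasoning

permutation-2-transitive : ∀ {m} {j j' k k' : Fin m} → j ≢ j' → k ≢ k' →
  ∃ λ (σ : Permutation′ m) → σ ⟨$⟩ʳ j ≡ k × σ ⟨$⟩ʳ j' ≡ k'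
permutation-2-transitive {j = j} {j'} {k} {k'} j≢j' k≢k' =
  τ Perm.∘ₚ τ' ,
  trans (cong (τ' ⟨$⟩ʳ_) (transpose-left j k)) (transpose-other k≢l k≢k') ,
  transpose-left l k'
  where
  τ = Perm.transpose j k
  l = τ ⟨$⟩ʳ j'
  τ' = Perm.transpose l k'
  k≢l : k ≢ l
  k≢l k≡l = j≢j' (permutation-injective τ (trans (transpose-left j k) k≡l))

order≥2 : ∀ {c} → FiniteField c → 2 ≤ c
order≥2 {zero} F with Inverse.from (FiniteField.enumeration F) (FiniteField.0# F)
... | ()
order≥2 {suc zero} F = ⊥-elim (0≢1 (begin
  0#                  ≡⟨ strictlyInverseˡ 0# ⟨
  to (from 0#)        ≡⟨ cong to (Fin1-unique (from 0#) (from 1#)) ⟩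
  to (from 1#)        ≡⟨ strictlyInverseˡ 1# ⟩
  1#                  ∎))
  where
  open FiniteField F
  open Inverse enumeration
  open ≡-Reasoning
  Fin1-unique : (i j : Fin 1) → i ≡ j
  Fin1-unique Fin.zero Fin.zero = refl
order≥2 {suc (suc _)} F = s≤s (s≤s z≤n)

-- FiniteField._-_ has no fixity declaration, so it binds tighter than _*_: hence (a * y) - (a * x).
module FieldProperties {c : ℕ} (F : FiniteField c) where
  open FiniteField F

  commutativeRing : CommutativeRing 0ℓ 0ℓ
  commutativeRing = record { isCommutativeRing = isCommutativeRing }

  open CommutativeRing commutativeRing public
    using (+-assoc; +-comm; +-identityˡ; -‿inverseʳ; *-assoc; *-comm; *-identityˡ; *-identityʳ;
           distribˡ; zeroˡ; zeroʳ)
  open CommutativeRing commutativeRing using (ring; +-group; +-abelianGroup)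
  open import Algebra.Properties.Ring ring using (x[y-z]≈xy-xz; [y-z]x≈yx-zx; -1*x≈-x)
  open import Algebra.Properties.Group +-group
    using (x∙y⁻¹≈ε⇒x≈y; inverseˡ-unique; ⁻¹-anti-homo-∙; //-rightDividesˡ; //-rightDividesʳ;
           \\-leftDividesˡ; \\-leftDividesʳ)
  open import Algebra.Properties.AbelianGroup +-abelianGroup using (⁻¹-anti-homo‿-)
  open ≡-Reasoning

  _≟_ : (x y : Carrier) → Dec (x ≡ y)
  _≟_ = via-injection (↔⇒↣ (↔-sym enumeration)) Fin._≟_

  x-y≡0⇒x≡y : ∀ {x y} → x - y ≡ 0# → x ≡ y
  x-y≡0⇒x≡y = x∙y⁻¹≈ε⇒x≈y _ _

  -[x-y]≡y-x : ∀ x y → - (x - y) ≡ y - x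
  -[x-y]≡y-x = ⁻¹-anti-homo‿-

  [x-y]+y≡x : ∀ x y → (x - y) + y ≡ x
  [x-y]+y≡x x y = //-rightDividesˡ y x

  x+[y-x]≡y : ∀ x y → x + (y - x) ≡ y
  x+[y-x]≡y x y = trans (+-comm x (y - x)) ([x-y]+y≡x y x)

  [y+x]-y≡x : ∀ y x → (y + x) - y ≡ x
  [y+x]-y≡x y x = trans (cong (_- y) (+-comm y x)) (//-rightDividesʳ y x)

  x≢x+w : ∀ {w} x → w ≢ 0# → x ≢ x + w
  x≢x+w {w} x w≢0 x≡x+w =
    w≢0 (trans (sym ([y+x]-y≡x x w)) (trans (cong (_- x) (sym x≡x+w)) (-‿inverseʳ x)))

  -1*x≡-x : ∀ x → - 1# * x ≡ - x
  -1*x≡-x = -1*x≈-x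

  affine-difference : ∀ a b x y → (a * y + b) - (a * x + b) ≡ a * (y - x)
  affine-difference a b x y = begin
    (a * y + b) + - (a * x + b)      ≡⟨ cong ((a * y + b) +_) (⁻¹-anti-homo-∙ (a * x) b) ⟩
    (a * y + b) + (- b + - (a * x))  ≡⟨ +-assoc (a * y) b _ ⟩
    a * y + (b + (- b + - (a * x)))  ≡⟨ cong (a * y +_) (\\-leftDividesˡ b (- (a * x))) ⟩
    (a * y) - (a * x)                ≡⟨ x[y-z]≈xy-xz a y x ⟨
    a * (y - x)                      ∎

  affine-through : ∀ {a p q p' q'} → a * (q - p) ≡ q' - p' →
    a * p + (p' - (a * p)) ≡ p' × a * q + (p' - (a * p)) ≡ q'
  affine-through {a} {p} {q} {p'} {q'} scaled =
    trans (+-comm (a * p) _) ([x-y]+y≡x p' (a * p)) , (begin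
    a * q + (p' - (a * p))   ≡⟨ cong (a * q +_) (+-comm p' _) ⟩
    a * q + (- (a * p) + p') ≡⟨ +-assoc (a * q) _ p' ⟨
    ((a * q) - (a * p)) + p' ≡⟨ cong (_+ p') (x[y-z]≈xy-xz a q p) ⟨
    a * (q - p) + p'         ≡⟨ cong (_+ p') scaled ⟩
    (q' - p') + p'           ≡⟨ [x-y]+y≡x q' p' ⟩
    q'                       ∎)

  affine-inverse : ∀ {a a'} b y → a * a' ≡ 1# → a * (a' * (y - b)) + b ≡ y
  affine-inverse {a} {a'} b y aa'≡1 = begin
    a * (a' * (y - b)) + b   ≡⟨ cong (_+ b) (*-assoc a a' _) ⟨
    (a * a') * (y - b) + b   ≡⟨ cong (λ u → u * (y - b) + b) aa'≡1 ⟩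
    1# * (y - b) + b         ≡⟨ cong (_+ b) (*-identityˡ _) ⟩
    (y - b) + b              ≡⟨ [x-y]+y≡x y b ⟩
    y                        ∎

  *-zeroProduct : ∀ {x y} → x * y ≡ 0# → x ≡ 0# ⊎ y ≡ 0#
  *-zeroProduct {x} {y} xy≡0 with x ≟ 0#
  ... | yes x≡0 = inj₁ x≡0
  ... | no x≢0 = let (x' , xx'≡1) = inverse x x≢0 in inj₂ (begin
    y              ≡⟨ *-identityˡ y ⟨
    1# * y         ≡⟨ cong (_* y) (trans (sym xx'≡1) (*-comm x x')) ⟩
    (x' * x) * y   ≡⟨ *-assoc x' x y ⟩
    x' * (x * y)   ≡⟨ cong (x' *_) xy≡0 ⟩
    x' * 0#        ≡⟨ zeroʳ x' ⟩
    0#             ∎)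

  *-≢0 : ∀ {x y} → x ≢ 0# → y ≢ 0# → x * y ≢ 0#
  *-≢0 x≢0 y≢0 xy≡0 with *-zeroProduct xy≡0
  ... | inj₁ x≡0 = x≢0 x≡0
  ... | inj₂ y≡0 = y≢0 y≡0

  *-cancelˡ : ∀ {a x y} → a ≢ 0# → a * x ≡ a * y → x ≡ y
  *-cancelˡ {a} {x} {y} a≢0 ax≡ay with *-zeroProduct a[x-y]≡0
    where
    a[x-y]≡0 : a * (x - y) ≡ 0#
    a[x-y]≡0 = trans (x[y-z]≈xy-xz a x y) (trans (cong (_- (a * y)) ax≡ay) (-‿inverseʳ (a * y)))
  ... | inj₁ a≡0 = ⊥-elim (a≢0 a≡0)
  ... | inj₂ x-y≡0 = x-y≡0⇒x≡y x-y≡0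

  [x-1][x+1]≡x²-1 : ∀ x → (x - 1#) * (x + 1#) ≡ (x * x) - 1#
  [x-1][x+1]≡x²-1 x = begin
    (x - 1#) * (x + 1#)                 ≡⟨ distribˡ (x - 1#) x 1# ⟩
    (x - 1#) * x + (x - 1#) * 1#        ≡⟨ cong₂ _+_ ([y-z]x≈yx-zx x x 1#) (*-identityʳ _) ⟩
    ((x * x) - (1# * x)) + (x - 1#)     ≡⟨ cong (λ u → ((x * x) - u) + (x - 1#)) (*-identityˡ x) ⟩
    ((x * x) - x) + (x - 1#)            ≡⟨ +-assoc (x * x) (- x) _ ⟩
    x * x + (- x + (x - 1#))            ≡⟨ cong (x * x +_) (\\-leftDividesʳ x (- 1#)) ⟩
    (x * x) - 1#                        ∎

  x²≡1⇒x≡±1 : ∀ {x} → x * x ≡ 1# → x ≡ 1# ⊎ x ≡ - 1#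
  x²≡1⇒x≡±1 {x} x²≡1
    with *-zeroProduct (trans ([x-1][x+1]≡x²-1 x) (trans (cong (_- 1#) x²≡1) (-‿inverseʳ 1#)))
  ... | inj₁ x-1≡0 = inj₁ (x-y≡0⇒x≡y x-1≡0)
  ... | inj₂ x+1≡0 = inj₂ (inverseˡ-unique x 1# x+1≡0)

  ^-+ : ∀ z a b → z ^ (a +ℕ b) ≡ z ^ a * z ^ b
  ^-+ z zero b = sym (*-identityˡ _)
  ^-+ z (suc a) b = trans (cong (z *_) (^-+ z a b)) (sym (*-assoc z _ _))

  ^-* : ∀ z a b → z ^ (a *ℕ b) ≡ (z ^ a) ^ b
  ^-* z a zero = cong (z ^_) (ℕ.*-zeroʳ a)
  ^-* z a (suc b) = begin
    z ^ (a *ℕ suc b)          ≡⟨ cong (z ^_) (ℕ.*-suc a b) ⟩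
    z ^ (a +ℕ a *ℕ b)         ≡⟨ ^-+ z a (a *ℕ b) ⟩
    z ^ a * z ^ (a *ℕ b)      ≡⟨ cong (z ^ a *_) (^-* z a b) ⟩
    z ^ a * (z ^ a) ^ b       ∎

  1^k≡1 : ∀ k → 1# ^ k ≡ 1#
  1^k≡1 zero = refl
  1^k≡1 (suc k) = trans (*-identityˡ _) (1^k≡1 k)

  ^-≢0 : ∀ {z} k → z ≢ 0# → z ^ k ≢ 0#
  ^-≢0 zero _ 1≡0 = 0≢1 (sym 1≡0)
  ^-≢0 (suc k) z≢0 = *-≢0 z≢0 (^-≢0 k z≢0)

  ^-periodic : ∀ {z p} → z ^ p ≡ 1# → ∀ k t → z ^ (k +ℕ t *ℕ p) ≡ z ^ k
  ^-periodic {z} {p} zᵖ≡1 k t = begin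
    z ^ (k +ℕ t *ℕ p)          ≡⟨ ^-+ z k (t *ℕ p) ⟩
    z ^ k * z ^ (t *ℕ p)       ≡⟨ cong (λ e → z ^ k * z ^ e) (ℕ.*-comm t p) ⟩
    z ^ k * z ^ (p *ℕ t)       ≡⟨ cong (z ^ k *_) (^-* z p t) ⟩
    z ^ k * (z ^ p) ^ t        ≡⟨ cong (λ u → z ^ k * u ^ t) zᵖ≡1 ⟩
    z ^ k * 1# ^ t             ≡⟨ cong (z ^ k *_) (1^k≡1 t) ⟩
    z ^ k * 1#                 ≡⟨ *-identityʳ _ ⟩
    z ^ k                      ∎

  ^-% : ∀ {z p} .{{_ : NonZero p}} → z ^ p ≡ 1# → ∀ k → z ^ k ≡ z ^ (k % p)
  ^-% {z} {p} zᵖ≡1 k = trans (cong (z ^_) (m≡m%n+[m/n]*n k p)) (^-periodic zᵖ≡1 (k % p) (k / p))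

  ^-difference : ∀ {z a b} → z ≢ 0# → a ≤ b → z ^ a ≡ z ^ b → z ^ (b ∸ a) ≡ 1#
  ^-difference {z} {a} {b} z≢0 a≤b zᵃ≡zᵇ = sym (*-cancelˡ (^-≢0 a z≢0) (begin
    z ^ a * 1#              ≡⟨ *-identityʳ _ ⟩
    z ^ a                   ≡⟨ zᵃ≡zᵇ ⟩
    z ^ b                   ≡⟨ cong (z ^_) (ℕ.m+[n∸m]≡n a≤b) ⟨
    z ^ (a +ℕ (b ∸ a))      ≡⟨ ^-+ z a (b ∸ a) ⟩
    z ^ a * z ^ (b ∸ a)     ∎))

module PrimitiveElement {r : ℕ} (F : FiniteField (suc r)) {ζ : FiniteField.Carrier F}
                        (isPrimitive : Primitive F ζ) (2≤r : 2 ≤ r) where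
  open FiniteField F
  open FieldProperties F
  open ≡-Reasoning
  private
    module E = Inverse enumeration

    to-injective : ∀ {i j} → E.to i ≡ E.to j → i ≡ j
    to-injective = Injection.injective (↔⇒↣ enumeration)

    from-injective : ∀ {x y} → E.from x ≡ E.from y → x ≡ y
    from-injective = Injection.injective (↔⇒↣ (↔-sym enumeration))

  nonzero : Fin r → Carrier
  nonzero i = E.to (Fin.punchIn (E.from 0#) i)

  nonzero-≢0 : ∀ i → nonzero i ≢ 0#
  nonzero-≢0 i nzᵢ≡0 =
    Fin.punchInᵢ≢i (E.from 0#) i (trans (sym (E.strictlyInverseʳ _)) (cong E.from nzᵢ≡0))

  nonzero-injective : ∀ {i j} → nonzero i ≡ nonzero j → i ≡ j
  nonzero-injective = Fin.punchIn-injective (E.from 0#) _ _ ∘ to-injective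

  index : ∀ x → x ≢ 0# → Fin r
  index x x≢0 = Fin.punchOut {i = E.from 0#} {j = E.from x} (x≢0 ∘ from-injective ∘ sym)

  index-injective : ∀ {x y} (x≢0 : x ≢ 0#) (y≢0 : y ≢ 0#) → index x x≢0 ≡ index y y≢0 → x ≡ y
  index-injective x≢0 y≢0 = from-injective ∘ Fin.punchOut-injective {i = E.from 0#} _ _

  -- were ζ = 0, every nonzero element would be a power ζ^0 = 1, yet there are r ≥ 2 of them
  ζ≢0 : ζ ≢ 0#
  ζ≢0 ζ≡0 with Fin.pigeonhole 2≤r (λ _ → Fin.zero {0})
  ... | i , j , i<j , _ = Fin.<⇒≢ i<j (nonzero-injective (trans (nonzero≡1 i) (sym (nonzero≡1 j))))
    where
    power≢0⇒≡1 : ∀ k → ζ ^ k ≢ 0# → ζ ^ k ≡ 1#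
    power≢0⇒≡1 zero _ = refl
    power≢0⇒≡1 (suc k) ζ¹⁺ᵏ≢0 = ⊥-elim (ζ¹⁺ᵏ≢0 (trans (cong (_* ζ ^ k) ζ≡0) (zeroˡ _)))
    nonzero≡1 : ∀ i → nonzero i ≡ 1#
    nonzero≡1 i with isPrimitive (nonzero i) (nonzero-≢0 i)
    ... | k , nzᵢ≡ζᵏ = trans nzᵢ≡ζᵏ (power≢0⇒≡1 k (nonzero-≢0 i ∘ trans nzᵢ≡ζᵏ))

  order-minimal : ∀ {p} .{{_ : NonZero p}} → ζ ^ p ≡ 1# → r ≤ p
  order-minimal {p} ζᵖ≡1 = ℕ.≮⇒≥ p≮r
    where
    exponent : Fin r → ℕ
    exponent i = proj₁ (isPrimitive (nonzero i) (nonzero-≢0 i))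
    mod-injective : ∀ {a b} → a mod p ≡ b mod p → a % p ≡ b % p
    mod-injective {a} {b} e =
      trans (sym (Fin.toℕ-fromℕ< (m%n<n a p))) (trans (cong toℕ e) (Fin.toℕ-fromℕ< (m%n<n b p)))
    p≮r : ¬ p < r
    p≮r p<r with Fin.pigeonhole p<r (λ i → exponent i mod p)
    ... | i , j , i<j , eᵢ≡eⱼ = Fin.<⇒≢ i<j (nonzero-injective (begin
      nonzero i                 ≡⟨ proj₂ (isPrimitive _ (nonzero-≢0 i)) ⟩
      ζ ^ exponent i            ≡⟨ ^-% ζᵖ≡1 (exponent i) ⟩
      ζ ^ (exponent i % p)      ≡⟨ cong (ζ ^_) (mod-injective eᵢ≡eⱼ) ⟩
      ζ ^ (exponent j % p)      ≡⟨ ^-% ζᵖ≡1 (exponent j) ⟨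
      ζ ^ exponent j            ≡⟨ proj₂ (isPrimitive _ (nonzero-≢0 j)) ⟨
      nonzero j                 ∎))

  ^-collision-gap : ∀ {a b} → a < b → ζ ^ a ≡ ζ ^ b → r ≤ b ∸ a
  ^-collision-gap a<b ζᵃ≡ζᵇ =
    order-minimal {{>-nonZero (ℕ.m<n⇒0<n∸m a<b)}} (^-difference ζ≢0 (ℕ.<⇒≤ a<b) ζᵃ≡ζᵇ)

  -- two of ζ^0, …, ζ^r coincide; their gap is at most r, and at least r by minimality
  ζ^r≡1 : ζ ^ r ≡ 1#
  ζ^r≡1 with Fin.pigeonhole (ℕ.n<1+n r) (λ k → index (ζ ^ toℕ k) (^-≢0 (toℕ k) ζ≢0))
  ... | i , j , i<j , indices≡ = subst (λ e → ζ ^ e ≡ 1#) j∸i≡r (^-difference ζ≢0 (ℕ.<⇒≤ i<j) ζⁱ≡ζʲ)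
    where
    ζⁱ≡ζʲ : ζ ^ toℕ i ≡ ζ ^ toℕ j
    ζⁱ≡ζʲ = index-injective (^-≢0 (toℕ i) ζ≢0) (^-≢0 (toℕ j) ζ≢0) indices≡
    j∸i≡r : toℕ j ∸ toℕ i ≡ r
    j∸i≡r = ℕ.≤-antisym (ℕ.≤-trans (ℕ.m∸n≤m (toℕ j) (toℕ i)) (s≤s⁻¹ (Fin.toℕ<n j)))
                        (^-collision-gap i<j ζⁱ≡ζʲ)

  no-collision-below-r : ∀ {a b} → a < b → b < r → ζ ^ a ≢ ζ ^ b
  no-collision-below-r {a} {b} a<b b<r ζᵃ≡ζᵇ =
    ℕ.<⇒≱ (ℕ.≤-<-trans (ℕ.m∸n≤m b a) b<r) (^-collision-gap a<b ζᵃ≡ζᵇ)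

  ^-injective : ∀ {a b} → a < r → b < r → ζ ^ a ≡ ζ ^ b → a ≡ b
  ^-injective {a} {b} a<r b<r ζᵃ≡ζᵇ with ℕ.<-cmp a b
  ... | tri< a<b _ _ = ⊥-elim (no-collision-below-r a<b b<r ζᵃ≡ζᵇ)
  ... | tri≈ _ a≡b _ = a≡b
  ... | tri> _ _ b<a = ⊥-elim (no-collision-below-r b<a a<r (sym ζᵃ≡ζᵇ))

  0<r : 0 < r
  0<r = ℕ.<-≤-trans (z<s {1}) 2≤r

  instance
    r≢0 : NonZero r
    r≢0 = >-nonZero 0<r

  -- junk value: log 0# = 0
  log : Carrier → ℕ
  log x with x ≟ 0#
  ... | yes _ = 0
  ... | no x≢0 = proj₁ (isPrimitive x x≢0) % r

  log<r : ∀ x → log x < r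
  log<r x with x ≟ 0#
  ... | yes _ = 0<r
  ... | no _ = m%n<n _ r

  ζ^log : ∀ {x} → x ≢ 0# → ζ ^ log x ≡ x
  ζ^log {x} x≢0 with x ≟ 0#
  ... | yes x≡0 = ⊥-elim (x≢0 x≡0)
  ... | no x≢0′ = sym (trans (proj₂ (isPrimitive x x≢0′)) (^-% ζ^r≡1 _))

  log-unique : ∀ {a x} → a < r → ζ ^ a ≡ x → log x ≡ a
  log-unique {a} a<r ζᵃ≡x =
    ^-injective (log<r _) a<r (trans (ζ^log (^-≢0 a ζ≢0 ∘ trans ζᵃ≡x)) (sym ζᵃ≡x))

  log-% : ∀ k {x} → ζ ^ k ≡ x → log x ≡ k % r
  log-% k ζᵏ≡x = log-unique (m%n<n k r) (trans (sym (^-% ζ^r≡1 k)) ζᵏ≡x)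

  module Halves {half : ℕ} (r≡half+half : r ≡ half +ℕ half) where
    0<half : 0 < half
    0<half = ℕ.n≢0⇒n>0 λ half≡0 → ℕ.<⇒≢ 0<r (sym (trans r≡half+half (cong (λ h → h +ℕ h) half≡0)))

    half<r : half < r
    half<r = subst (half <_) (sym r≡half+half) (ℕ.m<m+n half 0<half)

    ζ^half≡-1 : ζ ^ half ≡ - 1#
    ζ^half≡-1 = [ (λ ζ^half≡1 → ⊥-elim (no-collision-below-r 0<half half<r (sym ζ^half≡1))) , id ]′
                  (x²≡1⇒x≡±1 square≡1)
      where
      square≡1 : ζ ^ half * ζ ^ half ≡ 1#
      square≡1 = trans (sym (^-+ ζ half half)) (trans (cong (ζ ^_) (sym r≡half+half)) ζ^r≡1)

    -ζᵏ≡ζ^[half+k] : ∀ k → - (ζ ^ k) ≡ ζ ^ (half +ℕ k)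
    -ζᵏ≡ζ^[half+k] k = begin
      - (ζ ^ k)            ≡⟨ -1*x≡-x (ζ ^ k) ⟨
      - 1# * ζ ^ k         ≡⟨ cong (_* ζ ^ k) ζ^half≡-1 ⟨
      ζ ^ half * ζ ^ k     ≡⟨ ^-+ ζ half k ⟨
      ζ ^ (half +ℕ k)      ∎

    log-neg-lower : ∀ {w} → w ≢ 0# → log w < half → log (- w) ≡ half +ℕ log w
    log-neg-lower {w} w≢0 lower = log-unique
      (subst (half +ℕ log w <_) (sym r≡half+half) (ℕ.+-monoʳ-< half lower))
      (trans (sym (-ζᵏ≡ζ^[half+k] (log w))) (cong -_ (ζ^log w≢0)))

    log-neg-upper : ∀ {w} → w ≢ 0# → half ≤ log w → log (- w) ≡ log w ∸ half
    log-neg-upper {w} w≢0 upper = log-unique (ℕ.≤-<-trans (ℕ.m∸n≤m (log w) half) (log<r w)) (sym (begin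
      - w                               ≡⟨ cong -_ (ζ^log w≢0) ⟨
      - (ζ ^ log w)                     ≡⟨ -ζᵏ≡ζ^[half+k] (log w) ⟩
      ζ ^ (half +ℕ log w)               ≡⟨ cong (λ k → ζ ^ (half +ℕ k)) (ℕ.m+[n∸m]≡n upper) ⟨
      ζ ^ (half +ℕ (half +ℕ e))         ≡⟨ cong (ζ ^_) (ℕ.+-assoc half half e) ⟨
      ζ ^ ((half +ℕ half) +ℕ e)         ≡⟨ cong (λ k → ζ ^ (k +ℕ e)) r≡half+half ⟨
      ζ ^ (r +ℕ e)                      ≡⟨ ^-+ ζ r e ⟩
      ζ ^ r * ζ ^ e                     ≡⟨ cong (_* ζ ^ e) ζ^r≡1 ⟩
      1# * ζ ^ e                        ≡⟨ *-identityˡ _ ⟩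
      ζ ^ e                             ∎))
      where
      e = log w ∸ half

    ¬lower⇒neg-lower : ∀ {w} → w ≢ 0# → ¬ log w < half → log (- w) < half
    ¬lower⇒neg-lower {w} w≢0 ¬lower = subst (_< half) (sym (log-neg-upper w≢0 upper))
      (subst (log w ∸ half <_) (ℕ.m+n∸m≡n half half)
        (ℕ.∸-monoˡ-< (subst (log w <_) r≡half+half (log<r w)) upper))
      where
      upper = ℕ.≮⇒≥ ¬lower

    lower⇒¬neg-lower : ∀ {w} → w ≢ 0# → log w < half → ¬ log (- w) < half
    lower⇒¬neg-lower w≢0 lower neg-lower =
      ℕ.<⇒≱ neg-lower (subst (half ≤_) (sym (log-neg-lower w≢0 lower)) (ℕ.m≤m+n half _))

module WreathAction {c : ℕ} (F : FiniteField c) {ζ : FiniteField.Carrier F}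
                    (ζ≢0 : ζ ≢ FiniteField.0# F) (n d : ℕ) where
  open FiniteField F
  open FieldProperties F
  open Setup F ζ n d

  translation : Carrier → Carrier → HElt
  translation x x' = record { a = 1# ; b = x' - x ; a∈⟨ζⁿ⟩ = 0 , cong (ζ ^_) (sym (ℕ.*-zeroʳ n)) }

  translation-sends : ∀ x x' → applyH (translation x x') x ≡ x'
  translation-sends x x' = trans (cong (_+ (x' - x)) (*-identityˡ x)) (x+[y-x]≡y x x')

  applyH-surjective : ∀ h y → ∃ λ x → applyH h x ≡ y
  applyH-surjective h y = a⁻¹ * (y - HElt.b h) , affine-inverse (HElt.b h) y (proj₂ invertible)
    where
    a≢0 : HElt.a h ≢ 0#
    a≢0 = ^-≢0 (n *ℕ proj₁ (HElt.a∈⟨ζⁿ⟩ h)) ζ≢0 ∘ trans (sym (proj₂ (HElt.a∈⟨ζⁿ⟩ h)))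
    invertible = inverse (HElt.a h) a≢0
    a⁻¹ = proj₁ invertible

  class-with-two-points : ∀ j → ∃[ p ] ∃[ q ] (InClass j p × InClass j q × ¬ (p ≡ q))
  class-with-two-points j = (0# , j) , (1# , j) , refl , refl , 0≢1 ∘ cong proj₁

  class-image : ∀ (g : GElt) (j : Fin d) → ∃[ j' ]
    ((∀ p → InClass j p → InClass j' (act g p))
     × (∀ q → InClass j' q → ∃[ p ] (InClass j p × act g p ≡ q)))
  class-image (h , σ) j = σ ⟨$⟩ʳ j , (λ { _ refl → refl }) , preimage
    where
    preimage : ∀ q → InClass (σ ⟨$⟩ʳ j) q → ∃[ p ] (InClass j p × act (h , σ) p ≡ q)
    preimage (y , _) refl = (proj₁ (applyH-surjective (h j) y) , j) , refl ,
                            cong (_, σ ⟨$⟩ʳ j) (proj₂ (applyH-surjective (h j) y))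

  Out-preserved : ∀ g u v → Out u → MapsTo g u v → Out v
  Out-preserved (_ , σ) (⟅ _ , _ ⟆⟨ _ ⟩) (⟅ _ , _ ⟆⟨ _ ⟩) out (inj₁ (refl , refl)) =
    out ∘ permutation-injective σ
  Out-preserved (_ , σ) (⟅ _ , _ ⟆⟨ _ ⟩) (⟅ _ , _ ⟆⟨ _ ⟩) out (inj₂ (refl , refl)) =
    out ∘ sym ∘ permutation-injective σ

  Out-transitive : ∀ u v → Out u → Out v → ∃[ g ] MapsTo g u v
  Out-transitive (⟅ (x , j) , (y , j') ⟆⟨ _ ⟩) (⟅ (x' , k) , (y' , k') ⟆⟨ _ ⟩) j≢j' k≢k'
    with permutation-2-transitive j≢j' k≢k'
  ... | σ , σj≡k , σj'≡k' = (h , σ) , inj₁ (cong₂ _,_ hx≡x' σj≡k , cong₂ _,_ hy≡y' σj'≡k')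
    where
    h : Fin d → HElt
    h m with m Fin.≟ j
    ... | yes _ = translation x x'
    ... | no _ = translation y y'
    hx≡x' : applyH (h j) x ≡ x'
    hx≡x' with j Fin.≟ j
    ... | yes _ = translation-sends x x'
    ... | no j≢j = ⊥-elim (j≢j refl)
    hy≡y' : applyH (h j') y ≡ y'
    hy≡y' with j' Fin.≟ j
    ... | yes j'≡j = ⊥-elim (j≢j' (sym j'≡j))
    ... | no _ = translation-sends y y'

  private
    orient : Carrier → (j : Fin d) → Carrier → (k : Fin d) → .(j ≢ k) →
             IncreasingPair d × (Carrier × Carrier)
    orient x j y k j≢k with j Fin.<? k
    ... | yes j<k = increasing j k j<k , x , y
    ... | no j≮k = increasing k j (Fin.≤∧≢⇒< (ℕ.≮⇒≥ j≮k) (j≢k ∘ sym)) , y , x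

    orient-< : ∀ x j y k .(j≢k : j ≢ k) (j<k : j Fin.< k) →
               orient x j y k j≢k ≡ (increasing j k j<k , x , y)
    orient-< x j y k _ j<k with j Fin.<? k
    ... | yes _ = refl
    ... | no j≮k = ⊥-elim (j≮k j<k)

    orient-swap : ∀ x j y k (j≢k : j ≢ k) → orient x j y k j≢k ≡ orient y k x j (j≢k ∘ sym)
    orient-swap x j y k j≢k with j Fin.<? k | k Fin.<? j
    ... | yes j<k | yes k<j = ⊥-elim (Fin.<-asym j<k k<j)
    ... | yes _   | no _    = refl
    ... | no _    | yes _   = refl
    ... | no j≮k  | no k≮j  = ⊥-elim (j≢k (Fin.≤-antisym (ℕ.≮⇒≥ k≮j) (ℕ.≮⇒≥ j≮k)))

  Out-size : ∃[ m ] (HasSize (UPairSetoid Point Out) m × 2 *ℕ m ≡ c *ℕ c *ℕ d *ℕ (d ∸ 1))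
  Out-size = choose2 d *ℕ (c *ℕ c) ,
    hasSize-byCanonicalForm (UPairSetoid Point Out) enum rep code code-rep rep-code code-cong ,
    (begin
      2 *ℕ (choose2 d *ℕ (c *ℕ c))     ≡⟨ ℕ.*-assoc 2 (choose2 d) (c *ℕ c) ⟨
      2 *ℕ choose2 d *ℕ (c *ℕ c)       ≡⟨ cong (_*ℕ (c *ℕ c)) (double-choose2 d) ⟩
      d *ℕ (d ∸ 1) *ℕ (c *ℕ c)         ≡⟨ ℕ.*-comm (d *ℕ (d ∸ 1)) (c *ℕ c) ⟩
      c *ℕ c *ℕ (d *ℕ (d ∸ 1))         ≡⟨ ℕ.*-assoc (c *ℕ c) d (d ∸ 1) ⟨
      c *ℕ c *ℕ d *ℕ (d ∸ 1)           ∎)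
    where
    open ≡-Reasoning
    A = IncreasingPair d × (Carrier × Carrier)

    enum : Fin (choose2 d *ℕ (c *ℕ c)) ↔ A
    enum = ↔-trans Fin.*↔× (choose2↔increasingPair d ×-↔ ↔-trans Fin.*↔× (enumeration ×-↔ enumeration))

    rep : A → Σ (UPair Point) Out
    rep (p@(increasing j k _) , x , y) = ⟅ (x , j) , (y , k) ⟆⟨ lo≢hi p ∘ cong proj₂ ⟩ , lo≢hi p

    code : Σ (UPair Point) Out → A
    code (⟅ (x , j) , (y , k) ⟆⟨ _ ⟩ , j≢k) = orient x j y k j≢k

    code-rep : ∀ a → code (rep a) ≡ a
    code-rep (p@(increasing j k j<k) , x , y) = orient-< x j y k (lo≢hi p) (recompute (j Fin.<? k) j<k)

    rep-code : ∀ s → proj₁ (rep (code s)) ≈ᵘ proj₁ s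
    rep-code (⟅ (x , j) , (y , k) ⟆⟨ _ ⟩ , _) with j Fin.<? k
    ... | yes _ = inj₁ (refl , refl)
    ... | no _ = inj₂ (refl , refl)

    code-cong : ∀ s t → proj₁ s ≈ᵘ proj₁ t → code s ≡ code t
    code-cong (⟅ _ , _ ⟆⟨ _ ⟩ , _) (⟅ _ , _ ⟆⟨ _ ⟩ , _) (inj₁ (refl , refl)) = refl
    code-cong (⟅ (x , j) , (y , k) ⟆⟨ _ ⟩ , j≢k) (⟅ _ , _ ⟆⟨ _ ⟩ , _) (inj₂ (refl , refl)) =
      orient-swap x j y k j≢k

module InnerOrbits {r : ℕ} (F : FiniteField (suc r)) {ζ : FiniteField.Carrier F}
                   (isPrimitive : Primitive F ζ) (2≤r : 2 ≤ r)
                   {n : ℕ} .{{_ : NonZero n}} (q : ℕ) (r≡q*[2n] : r ≡ q *ℕ (2 *ℕ n)) (d : ℕ) where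
  open FiniteField F
  open FieldProperties F
  open PrimitiveElement F isPrimitive 2≤r
  open Setup F ζ n d
  open ≡-Reasoning

  half : ℕ
  half = q *ℕ n

  r≡half+half : r ≡ half +ℕ half
  r≡half+half = trans r≡q*[2n] (q*[2n]≡qn+qn q n)
    where
    q*[2n]≡qn+qn : ∀ q n → q *ℕ (2 *ℕ n) ≡ q *ℕ n +ℕ q *ℕ n
    q*[2n]≡qn+qn = solve-∀

  open Halves {half} r≡half+half

  n∣r : n ∣ r
  n∣r = divides (q *ℕ 2) (trans r≡q*[2n] (sym (ℕ.*-assoc q 2 n)))

  InO⇒power : ∀ i {x y} → InO i x y → ∃ λ e → y - x ≡ ζ ^ (i +ℕ e *ℕ n)
  InO⇒power i (inj₁ y-x≡ζ^) = y-x≡ζ^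
  InO⇒power i {x} {y} (inj₂ (t , x-y≡ζ^)) = t +ℕ q , (begin
    y - x                           ≡⟨ -[x-y]≡y-x x y ⟨
    - (x - y)                       ≡⟨ cong -_ x-y≡ζ^ ⟩
    - (ζ ^ (i +ℕ t *ℕ n))           ≡⟨ -ζᵏ≡ζ^[half+k] (i +ℕ t *ℕ n) ⟩
    ζ ^ (half +ℕ (i +ℕ t *ℕ n))     ≡⟨ cong (ζ ^_) (exponent i t q n) ⟩
    ζ ^ (i +ℕ (t +ℕ q) *ℕ n)        ∎)
    where
    exponent : ∀ i t q n → q *ℕ n +ℕ (i +ℕ t *ℕ n) ≡ i +ℕ (t +ℕ q) *ℕ n
    exponent = solve-∀

  log-of-power : ∀ {i w} e → i < n → ζ ^ (i +ℕ e *ℕ n) ≡ w → log w % n ≡ i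
  log-of-power {i} {w} e i<n ζ^≡w = begin
    log w % n                   ≡⟨ cong (_% n) (log-% (i +ℕ e *ℕ n) ζ^≡w) ⟩
    (i +ℕ e *ℕ n) % r % n       ≡⟨ m∣n⇒o%n%m≡o%m n r (i +ℕ e *ℕ n) n∣r ⟩
    (i +ℕ e *ℕ n) % n           ≡⟨ [m+kn]%n≡m%n i e n ⟩
    i % n                       ≡⟨ m<n⇒m%n≡m i<n ⟩
    i                           ∎

  InO⇒log : ∀ {i x y} → i < n → InO i x y → log (y - x) % n ≡ i
  InO⇒log {i} i<n inO = let (e , y-x≡ζ^) = InO⇒power i inO in log-of-power e i<n (sym y-x≡ζ^)

  Inner⇒Inn : ∀ u → Inner u → ∃[ i ] Inn (toℕ {n} i) u
  Inner⇒Inn (⟅ (x , j) , (y , _) ⟆⟨ x≢y ⟩) refl = L mod n , refl , inj₁ (L / n , (begin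
    y - x                                  ≡⟨ ζ^log y-x≢0 ⟨
    ζ ^ L                                  ≡⟨ cong (ζ ^_) (m≡m%n+[m/n]*n L n) ⟩
    ζ ^ (L % n +ℕ L / n *ℕ n)              ≡⟨ cong (λ i → ζ ^ (i +ℕ L / n *ℕ n)) (Fin.toℕ-fromℕ< L%n<n) ⟨
    ζ ^ (toℕ (L mod n) +ℕ L / n *ℕ n)      ∎))
    where
    L = log (y - x)
    L%n<n = m%n<n L n
    y-x≢0 : y - x ≢ 0#
    y-x≢0 = x≢y ∘ cong (_, j) ∘ sym ∘ x-y≡0⇒x≡y

  Inn-unique : ∀ u (i k : Fin n) → Inn (toℕ i) u → Inn (toℕ k) u → i ≡ k
  Inn-unique _ i k (_ , inOᵢ) (_ , inOₖ) =
    Fin.toℕ-injective (trans (sym (InO⇒log (Fin.toℕ<n i) inOᵢ)) (InO⇒log (Fin.toℕ<n k) inOₖ))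

  InOrd-preserved : ∀ i h {x y} → InOrd i x y → InOrd i (applyH h x) (applyH h y)
  InOrd-preserved i h {x} {y} (t , y-x≡ζ^) = t +ℕ t₀ , (begin
    applyH h y - applyH h x                   ≡⟨ affine-difference (HElt.a h) (HElt.b h) x y ⟩
    HElt.a h * (y - x)                        ≡⟨ cong₂ _*_ a≡ζ^ y-x≡ζ^ ⟩
    ζ ^ (n *ℕ t₀) * ζ ^ (i +ℕ t *ℕ n)         ≡⟨ ^-+ ζ (n *ℕ t₀) (i +ℕ t *ℕ n) ⟨
    ζ ^ (n *ℕ t₀ +ℕ (i +ℕ t *ℕ n))            ≡⟨ cong (ζ ^_) (exponent n t₀ i t) ⟩
    ζ ^ (i +ℕ (t +ℕ t₀) *ℕ n)                 ∎)
    where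
    t₀ = proj₁ (HElt.a∈⟨ζⁿ⟩ h)
    a≡ζ^ = proj₂ (HElt.a∈⟨ζⁿ⟩ h)
    exponent : ∀ n t₀ i t → n *ℕ t₀ +ℕ (i +ℕ t *ℕ n) ≡ i +ℕ (t +ℕ t₀) *ℕ n
    exponent = solve-∀

  InO-preserved : ∀ i h {x y} → InO i x y → InO i (applyH h x) (applyH h y)
  InO-preserved i h = map (InOrd-preserved i h) (InOrd-preserved i h)

  Inn-preserved : ∀ i g u v → Inn i u → MapsTo g u v → Inn i v
  Inn-preserved i (h , _) (⟅ (_ , j) , _ ⟆⟨ _ ⟩) (⟅ _ , _ ⟆⟨ _ ⟩) (refl , inO) (inj₁ (refl , refl)) =
    refl , InO-preserved i (h j) inO
  Inn-preserved i (h , _) (⟅ (_ , j) , _ ⟆⟨ _ ⟩) (⟅ _ , _ ⟆⟨ _ ⟩) (refl , inO) (inj₂ (refl , refl)) =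
    refl , ⊎-swap (InO-preserved i (h j) inO)

  -- ζ^(n t (r - 1)) inverts ζ^(t n), so ⟨ζⁿ⟩ carries every ζ^(i + t n) to every ζ^(i + s n)
  power-shift : ∀ i t s → ζ ^ (n *ℕ (s +ℕ t *ℕ (r ∸ 1))) * ζ ^ (i +ℕ t *ℕ n) ≡ ζ ^ (i +ℕ s *ℕ n)
  power-shift i t s = begin
    ζ ^ (n *ℕ t') * ζ ^ (i +ℕ t *ℕ n)                   ≡⟨ ^-+ ζ (n *ℕ t') (i +ℕ t *ℕ n) ⟨
    ζ ^ (n *ℕ t' +ℕ (i +ℕ t *ℕ n))                      ≡⟨ cong (ζ ^_) (exponent n s t i (r ∸ 1)) ⟩
    ζ ^ ((i +ℕ s *ℕ n) +ℕ (t *ℕ n) *ℕ (1 +ℕ (r ∸ 1)))   ≡⟨ cong (λ p → ζ ^ ((i +ℕ s *ℕ n) +ℕ (t *ℕ n) *ℕ p))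
                                                             1+[r∸1]≡r ⟩
    ζ ^ ((i +ℕ s *ℕ n) +ℕ (t *ℕ n) *ℕ r)                ≡⟨ ^-periodic ζ^r≡1 (i +ℕ s *ℕ n) (t *ℕ n) ⟩
    ζ ^ (i +ℕ s *ℕ n)                                   ∎
    where
    t' = s +ℕ t *ℕ (r ∸ 1)
    1+[r∸1]≡r : 1 +ℕ (r ∸ 1) ≡ r
    1+[r∸1]≡r = ℕ.m+[n∸m]≡n 0<r
    exponent : ∀ n s t i R → n *ℕ (s +ℕ t *ℕ R) +ℕ (i +ℕ t *ℕ n) ≡ (i +ℕ s *ℕ n) +ℕ (t *ℕ n) *ℕ (1 +ℕ R)
    exponent = solve-∀

  H-connects : ∀ i t s {x y x' y'} → y - x ≡ ζ ^ (i +ℕ t *ℕ n) → y' - x' ≡ ζ ^ (i +ℕ s *ℕ n) →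
    ∃ λ h → applyH h x ≡ x' × applyH h y ≡ y'
  H-connects i t s {x} {y} {x'} {y'} y-x≡ζ^ y'-x'≡ζ^ = h , affine-through (begin
    ζ ^ (n *ℕ t') * (y - x)                   ≡⟨ cong (ζ ^ (n *ℕ t') *_) y-x≡ζ^ ⟩
    ζ ^ (n *ℕ t') * ζ ^ (i +ℕ t *ℕ n)         ≡⟨ power-shift i t s ⟩
    ζ ^ (i +ℕ s *ℕ n)                         ≡⟨ y'-x'≡ζ^ ⟨
    y' - x'                                   ∎)
    where
    t' = s +ℕ t *ℕ (r ∸ 1)
    h : HElt
    h = record { a = ζ ^ (n *ℕ t') ; b = x' - (ζ ^ (n *ℕ t') * x) ; a∈⟨ζⁿ⟩ = t' , refl }

  Inn-transitive : ∀ i u v → Inn i u → Inn i v → ∃[ g ] MapsTo g u v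
  Inn-transitive i (⟅ (x , j) , (y , _) ⟆⟨ _ ⟩) (⟅ (x' , k) , (y' , _) ⟆⟨ _ ⟩)
                 (refl , inO) (refl , inO') =
    let (t , y-x≡ζ^) = InO⇒power i inO
        (s , y'-x'≡ζ^) = InO⇒power i inO'
        (h , hx≡x' , hy≡y') = H-connects i t s y-x≡ζ^ y'-x'≡ζ^
        σj≡k = transpose-left j k
    in ((λ _ → h) , Perm.transpose j k) , inj₁ (cong₂ _,_ hx≡x' σj≡k , cong₂ _,_ hy≡y' σj≡k)

  module _ {i : ℕ} (i<n : i < n) where
    private
      step : Fin q → Carrier
      step t = ζ ^ (i +ℕ toℕ t *ℕ n)

      step<half : ∀ (t : Fin q) → i +ℕ toℕ t *ℕ n < half
      step<half t = ℕ.<-≤-trans (ℕ.+-monoˡ-< (toℕ t *ℕ n) i<n) (ℕ.*-monoˡ-≤ n (Fin.toℕ<n t))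

      log-difference : ∀ x t → log ((x + step t) - x) ≡ i +ℕ toℕ t *ℕ n
      log-difference x t = log-unique (ℕ.<-trans (step<half t) half<r) (sym ([y+x]-y≡x x (step t)))

      -- a difference ζ^(i + t n) in the lower half of the exponents is recorded by t < q
      quotient-index : ∀ {w} → .(log w < half) → Fin q
      quotient-index {w} lower = Fin.fromℕ< (m<n*o⇒m/o<n lower)

      quotient-index-step : ∀ {w} t → log w ≡ i +ℕ toℕ t *ℕ n → .(lower : log w < half) →
        quotient-index lower ≡ t
      quotient-index-step {w} t log≡ _ = Fin.toℕ-injective (begin
        toℕ (Fin.fromℕ< _)                  ≡⟨ Fin.toℕ-fromℕ< _ ⟩
        log w / n                           ≡⟨ cong (_/ n) log≡ ⟩
        (i +ℕ toℕ t *ℕ n) / n               ≡⟨ +-distrib-/-∣ʳ i (divides (toℕ t) refl) ⟩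
        i / n +ℕ toℕ t *ℕ n / n             ≡⟨ cong₂ _+ℕ_ (m<n⇒m/n≡0 i<n) (m*n/n≡m (toℕ t) n) ⟩
        toℕ t                               ∎)

      quotient-index-reaches : ∀ {x y} → InO i x y → x ≢ y → (lower : log (y - x) < half) →
        x + step (quotient-index lower) ≡ y
      quotient-index-reaches {x} {y} inO x≢y lower = begin
        x + step (quotient-index lower)   ≡⟨ cong (λ t → x + ζ ^ (i +ℕ t *ℕ n)) (Fin.toℕ-fromℕ< L/n<q) ⟩
        x + ζ ^ (i +ℕ L / n *ℕ n)         ≡⟨ cong (λ i → x + ζ ^ (i +ℕ L / n *ℕ n)) (InO⇒log i<n inO) ⟨
        x + ζ ^ (L % n +ℕ L / n *ℕ n)     ≡⟨ cong (λ k → x + ζ ^ k) (m≡m%n+[m/n]*n L n) ⟨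
        x + ζ ^ L                         ≡⟨ cong (x +_) (ζ^log (x≢y ∘ sym ∘ x-y≡0⇒x≡y)) ⟩
        x + (y - x)                       ≡⟨ x+[y-x]≡y x y ⟩
        y                                 ∎
        where
        L = log (y - x)
        L/n<q = m<n*o⇒m/o<n lower

      swap-lower : ∀ {x y} → x ≢ y → ¬ log (y - x) < half → log (x - y) < half
      swap-lower {x} {y} x≢y ¬lower =
        subst (λ w → log w < half) (-[x-y]≡y-x y x) (¬lower⇒neg-lower (x≢y ∘ sym ∘ x-y≡0⇒x≡y) ¬lower)

      A = Fin d × (Carrier × Fin q)

      rep : A → Σ (UPair Point) (Inn i)
      rep (j , x , t) =
        ⟅ (x , j) , (x + step t , j) ⟆⟨ x≢x+w x (^-≢0 (i +ℕ toℕ t *ℕ n) ζ≢0) ∘ cong proj₁ ⟩ ,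
        refl , inj₁ (toℕ t , [y+x]-y≡x x (step t))

      -- {x, y} is recorded from the endpoint x with log (y - x) < half
      orient : Fin d → (x y : Carrier) → .(x ≢ y) → A
      orient j x y x≢y with log (y - x) ℕ.<? half
      ... | yes lower = j , x , quotient-index lower
      ... | no ¬lower = j , y , quotient-index (swap-lower x≢y ¬lower)

      orient-lower : ∀ j x y .(x≢y : x ≢ y) (lower : log (y - x) < half) →
        orient j x y x≢y ≡ (j , x , quotient-index lower)
      orient-lower j x y _ lower with log (y - x) ℕ.<? half
      ... | yes _ = refl
      ... | no ¬lower = ⊥-elim (¬lower lower)

      orient-swap : ∀ j x y (x≢y : x ≢ y) → orient j x y x≢y ≡ orient j y x (x≢y ∘ sym)
      orient-swap j x y x≢y with log (y - x) ℕ.<? half | log (x - y) ℕ.<? half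
      ... | yes lower | yes lower′ = ⊥-elim (lower⇒¬neg-lower (x≢y ∘ sym ∘ x-y≡0⇒x≡y) lower
                                       (subst (λ w → log w < half) (sym (-[x-y]≡y-x y x)) lower′))
      ... | yes _     | no _       = refl
      ... | no _      | yes _      = refl
      ... | no ¬lower | no ¬lower′ = ⊥-elim (¬lower′ (swap-lower x≢y ¬lower))

    Inn-size : ∃[ m ] (HasSize (UPairSetoid Point (Inn i)) m × 2 *ℕ n *ℕ m ≡ d *ℕ suc r *ℕ r)
    Inn-size = d *ℕ (suc r *ℕ q) ,
      hasSize-byCanonicalForm (UPairSetoid Point (Inn i)) enum rep code code-rep rep-code code-cong ,
      trans (count n q d (suc r)) (cong (d *ℕ suc r *ℕ_) (sym r≡q*[2n]))
      where
      enum : Fin (d *ℕ (suc r *ℕ q)) ↔ A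
      enum = ↔-trans Fin.*↔× (↔-refl ×-↔ ↔-trans Fin.*↔× (enumeration ×-↔ ↔-refl))

      code : Σ (UPair Point) (Inn i) → A
      code (⟅ (x , j) , (y , j') ⟆⟨ p≢q ⟩ , (j≡j' , _)) = orient j x y (p≢q ∘ λ x≡y → cong₂ _,_ x≡y j≡j')

      code-rep : ∀ a → code (rep a) ≡ a
      code-rep (j , x , t) =
        trans (orient-lower j x (x + step t) _ lower)
              (cong (λ t → j , x , t) (quotient-index-step t (log-difference x t) lower))
        where
        lower : log ((x + step t) - x) < half
        lower = subst (_< half) (sym (log-difference x t)) (step<half t)

      rep-code : ∀ s → proj₁ (rep (code s)) ≈ᵘ proj₁ s
      rep-code (⟅ (x , j) , (y , _) ⟆⟨ p≢q ⟩ , (refl , inO)) with log (y - x) ℕ.<? half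
      ... | yes lower = inj₁ (refl , cong (_, j) (quotient-index-reaches inO x≢y lower))
        where x≢y = p≢q ∘ cong (_, j)
      ... | no ¬lower =
        inj₂ (refl , cong (_, j) (quotient-index-reaches (⊎-swap inO) (x≢y ∘ sym) (swap-lower x≢y ¬lower)))
        where x≢y = p≢q ∘ cong (_, j)

      code-cong : ∀ s t → proj₁ s ≈ᵘ proj₁ t → code s ≡ code t
      code-cong (⟅ _ , _ ⟆⟨ _ ⟩ , _) (⟅ _ , _ ⟆⟨ _ ⟩ , _) (inj₁ (refl , refl)) = refl
      code-cong (⟅ (x , j) , (y , _) ⟆⟨ p≢q ⟩ , (refl , _)) (⟅ _ , _ ⟆⟨ _ ⟩ , _) (inj₂ (refl , refl)) =
        orient-swap j x y (p≢q ∘ cong (_, j))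

      count : ∀ n q d c → 2 *ℕ n *ℕ (d *ℕ (c *ℕ q)) ≡ d *ℕ c *ℕ (q *ℕ (2 *ℕ n))
      count = solve-∀

open import Data.Nat using (_*_)

lemma5p2 : {c : ℕ} (F : FiniteField c) (n : ℕ) → 1 ≤ n → 2 * n ∣ c ∸ 1 →
  (ζ : FiniteField.Carrier F) → Primitive F ζ →
  (d : ℕ) → 2 ≤ d →
  let open Setup F ζ n d in
  -- (a) the partition into classes C_j is non-trivial and G-invariant
  (((∃[ j ] ∃[ p ] ∃[ q ] (InClass j p × InClass j q × ¬ (p ≡ q)))
    × (Σ (Fin d) λ j → Σ (Fin d) λ j' → ¬ (j ≡ j')))
   × (∀ (g : GElt) (j : Fin d) → ∃[ j' ]
        ((∀ p → InClass j p → InClass j' (act g p))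
         × (∀ q → InClass j' q → ∃[ p ] (InClass j p × act g p ≡ q)))))
  -- (b) G is transitive on O_out, and |O_out| = c²d(d-1)/2
  × ((∀ g u v → Out u → MapsTo g u v → Out v)
     × (∀ u v → Out u → Out v → ∃[ g ] MapsTo g u v)
     × (∃[ m ] (HasSize (UPairSetoid Point Out) m
                × 2 * m ≡ c * c * d * (d ∸ 1))))
  -- (c) the G-orbits on inner pairs are exactly O_inn,i (0 ≤ i < n),
  --     each of size dc(c-1)/(2n)
  × ((∀ u → Inner u → ∃[ i ] Inn (toℕ {n} i) u)
     × (∀ u (i k : Fin n) → Inn (toℕ i) u → Inn (toℕ k) u → i ≡ k)
     × (∀ (i : Fin n) →
          (∀ g u v → Inn (toℕ i) u → MapsTo g u v → Inn (toℕ i) v)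
          × (∀ u v → Inn (toℕ i) u → Inn (toℕ i) v → ∃[ g ] MapsTo g u v)
          × (∃[ m ] (HasSize (UPairSetoid Point (Inn (toℕ i))) m
                     × 2 * n * m ≡ d * c * (c ∸ 1)))))
lemma5p2 {zero} F _ _ _ _ _ _ _ with order≥2 F
... | ()
lemma5p2 {suc r} F n 1≤n (divides q r≡q*[2n]) ζ isPrimitive d@(suc (suc _)) (s≤s (s≤s _)) =
  (((Fin.zero , W.class-with-two-points Fin.zero) , (Fin.zero , Fin.suc Fin.zero , λ ())) ,
   W.class-image) ,
  (W.Out-preserved , W.Out-transitive , W.Out-size) ,
  (I.Inner⇒Inn , I.Inn-unique ,
   λ i → I.Inn-preserved (toℕ i) , I.Inn-transitive (toℕ i) , I.Inn-size (Fin.toℕ<n i))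
  where
  instance
    n≢0 : NonZero n
    n≢0 = >-nonZero 1≤n
    r≢0 : NonZero r
    r≢0 = >-nonZero (s≤s⁻¹ (order≥2 F))
  2≤r : 2 ≤ r
  2≤r = ℕ.≤-trans (ℕ.*-monoʳ-≤ 2 1≤n) (∣⇒≤ (divides q r≡q*[2n]))
  module P = PrimitiveElement F isPrimitive 2≤r
  module W = WreathAction F P.ζ≢0 n d
  module I = InnerOrbits F isPrimitive 2≤r q r≡q*[2n] d
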